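{- Let $a_n$ denote the number of Deutsch paths of length $n$ from $(0,0)$ to $(n,0)$ with the property that every maximal run of consecutive down-steps that ends on the $x$-axis starts at an odd level. Then \[ \sum_{n\ge0} a_n z^n=\frac{1}{1-\dfrac{z^2}{1-(1+z)^2/u_1^2}}=\frac{3+z-\sqrt{1-2z-3z^2}}{2(1+z)}=\frac{1+2v+2v^2}{(1+v)^2}, \] where $u_1=\frac{1+z+\sqrt{1-2z-3z^2}}{2z}$ and $v=v(z)=\frac{1-z-\sqrt{1-2z-3z^2}}{2z}$ (so that $z=\frac{v}{1+v+v^2}$). In particular the series begins $1+z^2+2z^4+2z^5+7z^6+14z^7+37z^8+90z^9+233z^{10}+\cdots$.
   Context: A Deutsch path is a lattice path starting at $(0,0)$ that uses up-steps $(1,1)$ and down-steps $(1,-j)$ for any integer $j\ge1$, and never goes below the $x$-axis; its length is its number of steps. A maximal run of down-steps is a maximal sequence of consecutive down-steps (of any sizes); it starts at the level (height) of the point where its first step begins. The empty path (length $0$) is counted. -}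

module Defs where

open import Data.Nat as ℕ using (ℕ; zero; suc; _∸_; _≤ᵇ_; _≡ᵇ_)
open import Data.Bool using (Bool; true; false; _∧_; if_then_else_)
open import Data.Maybe using (Maybe; just; nothing)
open import Data.List using (List; []; _∷_; length; map; upTo)
open import Data.Integer as ℤ using (ℤ; +_; _+_; _*_; -_; _-_)
open import Data.Integer.Properties using ()
open import Data.Product using (Σ; _×_)
open import Relation.Binary.PropositionalEquality using (_≡_)

-- A step: `up` is (1,1); `down j` is (1,-(suc j)), i.e. a down-step of
-- size suc j ≥ 1.
data Step : Set where
  up   : Step
  down : ℕ → Step

oddᵇ : ℕ → Bool
oddᵇ zero          = false
oddᵇ (suc zero)    = true
oddᵇ (suc (suc n)) = oddᵇ n

-- Closing a maximal run of down-steps: `r` is the start level of the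
-- current run (nothing if we are not inside a down run), `h` is the
-- current height.
runOK : Maybe ℕ → ℕ → Bool
runOK nothing  h = true
runOK (just s) h = if h ≡ᵇ 0 then oddᵇ s else true

valid : ℕ → Maybe ℕ → List Step → Bool
valid h r []             = (h ≡ᵇ 0) ∧ runOK r h
valid h r (up ∷ p)       = runOK r h ∧ valid (suc h) nothing p
valid h nothing (down j ∷ p)  = (suc j ≤ᵇ h) ∧ valid (h ∸ suc j) (just h) p
valid h (just s) (down j ∷ p) = (suc j ≤ᵇ h) ∧ valid (h ∸ suc j) (just s) p

GoodPaths : ℕ → Set
GoodPaths n = Σ (List Step) λ p → (length p ≡ n) × (valid 0 nothing p ≡ true)

Series : Set
Series = ℕ → ℤ

_≈ₛ_ : Series → Series → Set
f ≈ₛ g = ∀ n → f n ≡ g n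
infix 4 _≈ₛ_

sumℤ : List ℤ → ℤ
sumℤ []       = + 0
sumℤ (x ∷ xs) = x + sumℤ xs

_+ₛ_ : Series → Series → Series
(f +ₛ g) n = f n + g n

_-ₛ_ : Series → Series → Series
(f -ₛ g) n = f n - g n

_*ₛ_ : Series → Series → Series
(f *ₛ g) n = sumℤ (map (λ k → f k * g (n ∸ k)) (upTo (suc n)))

infixl 6 _+ₛ_ _-ₛ_
infixl 7 _*ₛ_

const : ℤ → Series
const c zero    = c
const c (suc _) = + 0

zₛ : Series
zₛ (suc zero) = + 1
zₛ _          = + 0

-- Let count h r L be the number of valid step sequences of length L read
-- from height h with pending-run state r, defined by the first-step
-- decomposition; a bijection with the paths shows aₙ = count 0 nothing n,
-- which also yields the listed coefficients.  Passing to generating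
-- functions, A = F₀ and the series E h (a run begun at an even level is
-- pending at height h) solve a linear system (Solves) whose right-hand sides
-- are multiples of z, so it has a unique solution.  For every v with
-- v = z(1 + v + v²) an explicit solution built from the geometric sequences
-- (1 + v)^h, (1 + z)^h and (−1 − z)^h is checked with the ring solver, and
-- comparing the two solutions gives (1 + z) A = 1 + z + z v.  The three
-- closed forms are algebraic consequences of this relation, for the
-- solution v̂ of the equation obtained by iteration.

module Submission where

open import Defs
open import Data.Nat as ℕ using (ℕ; zero; suc; _∸_; z≤n; s≤s)
import Data.Nat.Properties as ℕₚ
open import Data.Integer as ℤ using (+_; -_; _+_; _*_; _-_)
import Data.Integer.Properties as ℤₚ
open import Data.Integer.Solver using (module +-*-Solver)
open import Data.List using (List; []; _∷_; length; applyUpTo)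
open import Data.List.Properties using (map-applyUpTo)
open import Data.Maybe using (Maybe; just; nothing)
open import Data.Bool using (true; false; _∧_; if_then_else_)
open import Data.Fin using (Fin)
open import Data.Product using (_×_; _,_)
open import Data.Sum using (inj₁; inj₂)
open import Data.Unit using (⊤; tt)
open import Function using (_∘_; id)
open import Function.Bundles using (_↔_)
open import Relation.Binary.PropositionalEquality
open import Relation.Nullary using (¬_; yes; no)
open import Algebra.Bundles using (CommutativeRing)
open import Algebra.Properties.AbelianGroup ℤₚ.+-0-abelianGroup using () renaming (∙-cancelʳ to +-cancelʳ)
import Algebra.Solver.Ring
import Algebra.Solver.Ring.AlmostCommutativeRing as ACR
import Relation.Binary.Reasoning.Setoid as SetoidReasoning

-- The ring of formal power series

shift : Series → Series
shift f n = f (suc n)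

0ₛ : Series
0ₛ _ = + 0

const0 : const (+ 0) ≈ₛ 0ₛ
const0 zero    = refl
const0 (suc n) = refl

negₛ : Series → Series
negₛ f n = - f n

-- Cauchy product written recursively in the first factor:
-- (f ⊛ g)ₙ₊₁ = f₀ gₙ₊₁ + (shift f ⊛ g)ₙ.  All ring laws are proved for
-- this form and transported to the list-based product _*ₛ_ of Defs.
infixl 7 _⊛_
_⊛_ : Series → Series → Series
(f ⊛ g) zero    = f 0 * g 0
(f ⊛ g) (suc n) = f 0 * g (suc n) + (shift f ⊛ g) n

*ₛ≈⊛ : ∀ f g → f *ₛ g ≈ₛ f ⊛ g
*ₛ≈⊛ f g n = trans (cong sumℤ (map-applyUpTo id (λ k → f k * g (n ∸ k)) (suc n))) (sum≡⊛ f n)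
  where
  sum≡⊛ : ∀ f n → sumℤ (applyUpTo (λ k → f k * g (n ∸ k)) (suc n)) ≡ (f ⊛ g) n
  sum≡⊛ f zero    = ℤₚ.+-identityʳ _
  sum≡⊛ f (suc n) = cong (_+_ (f 0 * g (suc n))) (sum≡⊛ (shift f) n)

module ⊛-Laws where
  open +-*-Solver using (solve; _:=_; _:+_; _:*_)

  ⊛-cong : ∀ {f f′ g g′} → f ≈ₛ f′ → g ≈ₛ g′ → f ⊛ g ≈ₛ f′ ⊛ g′
  ⊛-cong f≈ g≈ zero    = cong₂ _*_ (f≈ 0) (g≈ 0)
  ⊛-cong f≈ g≈ (suc n) = cong₂ _+_ (cong₂ _*_ (f≈ 0) (g≈ (suc n))) (⊛-cong (f≈ ∘ suc) g≈ n)

  ⊛-zeroˡ : ∀ g → 0ₛ ⊛ g ≈ₛ 0ₛ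
  ⊛-zeroˡ g zero    = refl
  ⊛-zeroˡ g (suc n) = cong₂ _+_ (ℤₚ.*-zeroˡ (g (suc n))) (⊛-zeroˡ g n)

  ⊛-identityˡ : ∀ f → const (+ 1) ⊛ f ≈ₛ f
  ⊛-identityˡ f zero    = ℤₚ.*-identityˡ (f 0)
  ⊛-identityˡ f (suc n) =
    trans (cong₂ _+_ (ℤₚ.*-identityˡ (f (suc n))) (⊛-zeroˡ f n)) (ℤₚ.+-identityʳ _)

  ⊛-distribʳ : ∀ f g h → (f +ₛ g) ⊛ h ≈ₛ f ⊛ h +ₛ g ⊛ h
  ⊛-distribʳ f g h zero    = ℤₚ.*-distribʳ-+ (h 0) (f 0) (g 0)
  ⊛-distribʳ f g h (suc n) =
    trans (cong (_+_ ((f 0 + g 0) * h (suc n))) (⊛-distribʳ (shift f) (shift g) h n))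
          (solve 5 (λ a b c x y → (a :+ b) :* c :+ (x :+ y) := (a :* c :+ x) :+ (b :* c :+ y))
                   refl (f 0) (g 0) (h (suc n)) ((shift f ⊛ h) n) ((shift g ⊛ h) n))

  ⊛-distribˡ : ∀ h f g → h ⊛ (f +ₛ g) ≈ₛ h ⊛ f +ₛ h ⊛ g
  ⊛-distribˡ h f g zero    = ℤₚ.*-distribˡ-+ (h 0) (f 0) (g 0)
  ⊛-distribˡ h f g (suc n) =
    trans (cong (_+_ (h 0 * (f (suc n) + g (suc n)))) (⊛-distribˡ (shift h) f g n))
          (solve 5 (λ a b c x y → a :* (b :+ c) :+ (x :+ y) := (a :* b :+ x) :+ (a :* c :+ y))
                   refl (h 0) (f (suc n)) (g (suc n)) ((shift h ⊛ f) n) ((shift h ⊛ g) n))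

  ⊛-scaleˡ : ∀ c f g → (λ n → c * f n) ⊛ g ≈ₛ (λ n → c * (f ⊛ g) n)
  ⊛-scaleˡ c f g zero    = ℤₚ.*-assoc c (f 0) (g 0)
  ⊛-scaleˡ c f g (suc n) =
    trans (cong (_+_ (c * f 0 * g (suc n))) (⊛-scaleˡ c (shift f) g n))
          (solve 4 (λ c a b x → c :* a :* b :+ c :* x := c :* (a :* b :+ x))
                   refl c (f 0) (g (suc n)) ((shift f ⊛ g) n))

  ⊛-unfoldʳ : ∀ f g n → (f ⊛ g) (suc n) ≡ (f ⊛ shift g) n + f (suc n) * g 0
  ⊛-unfoldʳ f g zero    = refl
  ⊛-unfoldʳ f g (suc n) =
    trans (cong (_+_ (f 0 * g (suc (suc n)))) (⊛-unfoldʳ (shift f) g n))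
          (sym (ℤₚ.+-assoc (f 0 * g (suc (suc n))) ((shift f ⊛ shift g) n) _))

  ⊛-comm : ∀ f g → f ⊛ g ≈ₛ g ⊛ f
  ⊛-comm f g zero    = ℤₚ.*-comm (f 0) (g 0)
  ⊛-comm f g (suc n) =
    trans (cong (_+_ (f 0 * g (suc n))) (⊛-comm (shift f) g n))
          (trans (solve 3 (λ a b x → a :* b :+ x := x :+ b :* a) refl (f 0) (g (suc n)) ((g ⊛ shift f) n))
                 (sym (⊛-unfoldʳ g f n)))

  ⊛-assoc : ∀ f g h → (f ⊛ g) ⊛ h ≈ₛ f ⊛ (g ⊛ h)
  ⊛-assoc f g h zero    = ℤₚ.*-assoc (f 0) (g 0) (h 0)
  ⊛-assoc f g h (suc n) =
    trans (cong (_+_ (f 0 * g 0 * h (suc n)))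
            (trans (⊛-distribʳ (λ k → f 0 * g (suc k)) (shift f ⊛ g) h n)
                   (cong₂ _+_ (⊛-scaleˡ (f 0) (shift g) h n) (⊛-assoc (shift f) g h n))))
          (solve 5 (λ a b c x y → a :* b :* c :+ (a :* x :+ y) := a :* (b :* c :+ x) :+ y)
                   refl (f 0) (g 0) (h (suc n)) ((shift g ⊛ h) n) ((shift f ⊛ (g ⊛ h)) n))

open ⊛-Laws

≈ₛ-refl : ∀ {f} → f ≈ₛ f
≈ₛ-refl _ = refl

≈ₛ-sym : ∀ {f g} → f ≈ₛ g → g ≈ₛ f
≈ₛ-sym f≈g n = sym (f≈g n)

≈ₛ-trans : ∀ {f g h} → f ≈ₛ g → g ≈ₛ h → f ≈ₛ h
≈ₛ-trans f≈g g≈h n = trans (f≈g n) (g≈h n)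

*ₛ-cong : ∀ {f f′ g g′} → f ≈ₛ f′ → g ≈ₛ g′ → f *ₛ g ≈ₛ f′ *ₛ g′
*ₛ-cong {f} {f′} {g} {g′} f≈ g≈ n =
  trans (*ₛ≈⊛ f g n) (trans (⊛-cong f≈ g≈ n) (sym (*ₛ≈⊛ f′ g′ n)))

seriesRing : CommutativeRing _ _
seriesRing = record
  { Carrier = Series ; _≈_ = _≈ₛ_ ; _+_ = _+ₛ_ ; _*_ = _*ₛ_ ; -_ = negₛ ; 0# = 0ₛ ; 1# = const (+ 1)
  ; isCommutativeRing = record
    { isRing = record
      { +-isAbelianGroup = record
        { isGroup = record
          { isMonoid = record
            { isSemigroup = record
              { isMagma = record
                { isEquivalence = record { refl = ≈ₛ-refl ; sym = ≈ₛ-sym ; trans = ≈ₛ-trans }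
                ; ∙-cong = λ f≈ g≈ n → cong₂ _+_ (f≈ n) (g≈ n) }
              ; assoc = λ f g h n → ℤₚ.+-assoc (f n) (g n) (h n) }
            ; identity = (λ f n → ℤₚ.+-identityˡ (f n)) , (λ f n → ℤₚ.+-identityʳ (f n)) }
          ; inverse = (λ f n → ℤₚ.+-inverseˡ (f n)) , (λ f n → ℤₚ.+-inverseʳ (f n))
          ; ⁻¹-cong = λ f≈ n → cong -_ (f≈ n) }
        ; comm = λ f g n → ℤₚ.+-comm (f n) (g n) }
      ; *-cong = *ₛ-cong
      ; *-assoc = λ f g h n →
          trans (*ₛ≈⊛ (f *ₛ g) h n) (trans (⊛-cong (*ₛ≈⊛ f g) ≈ₛ-refl n)
            (trans (⊛-assoc f g h n)
              (trans (⊛-cong ≈ₛ-refl (≈ₛ-sym (*ₛ≈⊛ g h)) n) (sym (*ₛ≈⊛ f (g *ₛ h) n)))))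
      ; *-identity =
          (λ f n → trans (*ₛ≈⊛ (const (+ 1)) f n) (⊛-identityˡ f n))
        , (λ f n → trans (*ₛ≈⊛ f (const (+ 1)) n) (trans (⊛-comm f _ n) (⊛-identityˡ f n)))
      ; distrib =
          (λ h f g n → trans (*ₛ≈⊛ h (f +ₛ g) n) (trans (⊛-distribˡ h f g n)
                         (sym (cong₂ _+_ (*ₛ≈⊛ h f n) (*ₛ≈⊛ h g n)))))
        , (λ h f g n → trans (*ₛ≈⊛ (f +ₛ g) h n) (trans (⊛-distribʳ f g h n)
                         (sym (cong₂ _+_ (*ₛ≈⊛ f h n) (*ₛ≈⊛ g h n)))))
      }
    ; *-comm = λ f g n → trans (*ₛ≈⊛ f g n) (trans (⊛-comm f g n) (sym (*ₛ≈⊛ g f n)))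
    }
  }

-- Integer constants embed into ℤ[[z]] as a ring homomorphism; this lets
-- the ring solver normalise series expressions with integer coefficients.
constHom : ℤ.+-*-rawRing ACR.-Raw-AlmostCommutative⟶ ACR.fromCommutativeRing seriesRing
constHom = record
  { ⟦_⟧    = const
  ; +-homo = λ { a b zero → refl ; a b (suc n) → refl }
  ; *-homo = λ a b n → sym (trans (*ₛ≈⊛ (const a) (const b) n) (const-⊛ a b n))
  ; -‿homo = λ { a zero → refl ; a (suc n) → refl }
  ; 0-homo = const0
  ; 1-homo = ≈ₛ-refl
  }
  where
  const-⊛ : ∀ a b → const a ⊛ const b ≈ₛ const (a * b)
  const-⊛ a b zero    = refl
  const-⊛ a b (suc n) = cong₂ _+_ (ℤₚ.*-zeroʳ a) (⊛-zeroˡ (const b) n)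

const≟ : ∀ a b → Maybe (const a ≈ₛ const b)
const≟ a b with a ℤ.≟ b
... | yes refl = just ≈ₛ-refl
... | no _     = nothing

module SeriesSolver =
  Algebra.Solver.Ring ℤ.+-*-rawRing (ACR.fromCommutativeRing seriesRing) constHom const≟
open SeriesSolver using (solve; _:=_; con; _:+_; _:*_; _:-_; :-_)

Agree : ℕ → Series → Series → Set
Agree L f g = ∀ k → k ℕ.< L → f k ≡ g k

coefficientInduction : ∀ {I : Set} {X Y : I → Series} →
  (∀ L → (∀ i → Agree L (X i) (Y i)) → ∀ i → X i L ≡ Y i L) → ∀ i → X i ≈ₛ Y i
coefficientInduction {X = X} {Y} step i n = agreeBelow (suc n) i n (ℕₚ.n<1+n n)
  where
  agreeBelow : ∀ L i → Agree L (X i) (Y i)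
  agreeBelow zero    i k ()
  agreeBelow (suc L) i k k<1+L with ℕₚ.m<1+n⇒m<n∨m≡n k<1+L
  ... | inj₁ k<L  = agreeBelow L i k k<L
  ... | inj₂ refl = step k (agreeBelow k) i

coefficientwise : ∀ {X Y} → (∀ L → Agree L X Y → X L ≡ Y L) → X ≈ₛ Y
coefficientwise step = coefficientInduction {I = ⊤} (λ L agree _ → step L (agree tt)) tt

+ₛ-agree : ∀ {L f f′ g g′} → Agree L f f′ → Agree L g g′ → Agree L (f +ₛ g) (f′ +ₛ g′)
+ₛ-agree f≈ g≈ k k<L = cong₂ _+_ (f≈ k k<L) (g≈ k k<L)

⊛-agree : ∀ n {f f′ g g′} → Agree (suc n) f f′ → Agree (suc n) g g′ → (f ⊛ g) n ≡ (f′ ⊛ g′) n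
⊛-agree zero    f≈ g≈ = cong₂ _*_ (f≈ 0 (s≤s z≤n)) (g≈ 0 (s≤s z≤n))
⊛-agree (suc n) f≈ g≈ =
  cong₂ _+_ (cong₂ _*_ (f≈ 0 (s≤s z≤n)) (g≈ (suc n) ℕₚ.≤-refl))
            (⊛-agree n (λ k k≤n → f≈ (suc k) (s≤s k≤n)) (λ k k<1+n → g≈ k (ℕₚ.m≤n⇒m≤1+n k<1+n)))

*ₛ-agree : ∀ {L f f′ g g′} → Agree L f f′ → Agree L g g′ → Agree L (f *ₛ g) (f′ *ₛ g′)
*ₛ-agree {f = f} {f′} {g} {g′} f≈ g≈ k k<L =
  trans (*ₛ≈⊛ f g k)
        (trans (⊛-agree k (λ j j≤k → f≈ j (ℕₚ.≤-<-trans (ℕₚ.≤-pred j≤k) k<L))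
                          (λ j j≤k → g≈ j (ℕₚ.≤-<-trans (ℕₚ.≤-pred j≤k) k<L)))
               (sym (*ₛ≈⊛ f′ g′ k)))

z*-zero : ∀ f → (zₛ *ₛ f) 0 ≡ + 0
z*-zero f = *ₛ≈⊛ zₛ f 0

z*-suc : ∀ f n → (zₛ *ₛ f) (suc n) ≡ f n
z*-suc f n = begin
  (zₛ *ₛ f) (suc n)                   ≡⟨ *ₛ≈⊛ zₛ f (suc n) ⟩
  + 0 * f (suc n) + (shift zₛ ⊛ f) n  ≡⟨ ℤₚ.+-identityˡ _ ⟩
  (shift zₛ ⊛ f) n                    ≡⟨ ⊛-cong shift-z ≈ₛ-refl n ⟩
  (const (+ 1) ⊛ f) n                 ≡⟨ ⊛-identityˡ f n ⟩
  f n                                 ∎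
  where
  open ≡-Reasoning
  shift-z : shift zₛ ≈ₛ const (+ 1)
  shift-z zero    = refl
  shift-z (suc n) = refl

z*-agree : ∀ {L f g} → Agree L f g → Agree (suc L) (zₛ *ₛ f) (zₛ *ₛ g)
z*-agree {f = f} {g} f≈ zero    _           = trans (z*-zero f) (sym (z*-zero g))
z*-agree {f = f} {g} f≈ (suc k) (s≤s k<L) = trans (z*-suc f k) (trans (f≈ k k<L) (sym (z*-suc g k)))

*ₛ-cancelʳ : ∀ {X X′} Y → ¬ (Y 0 ≡ + 0) → X *ₛ Y ≈ₛ X′ *ₛ Y → X ≈ₛ X′
*ₛ-cancelʳ {X} {X′} Y Y₀≢0 XY≈X′Y = coefficientwise step
  where
  instance
    Y₀-nonZero : ℤ.NonZero (Y 0)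
    Y₀-nonZero = ℤ.≢-nonZero Y₀≢0
  YX≈YX′ : Y ⊛ X ≈ₛ Y ⊛ X′
  YX≈YX′ n = begin
    (Y ⊛ X) n    ≡⟨ ⊛-comm Y X n ⟩
    (X ⊛ Y) n    ≡⟨ sym (*ₛ≈⊛ X Y n) ⟩
    (X *ₛ Y) n   ≡⟨ XY≈X′Y n ⟩
    (X′ *ₛ Y) n  ≡⟨ *ₛ≈⊛ X′ Y n ⟩
    (X′ ⊛ Y) n   ≡⟨ ⊛-comm X′ Y n ⟩
    (Y ⊛ X′) n   ∎
    where open ≡-Reasoning
  -- In degree L the product is Y₀ X_L plus terms involving X below L only.
  step : ∀ L → Agree L X X′ → X L ≡ X′ L
  step zero    _ = ℤₚ.*-cancelˡ-≡ (Y 0) (X 0) (X′ 0) (YX≈YX′ 0)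
  step (suc m) X≈ = ℤₚ.*-cancelˡ-≡ (Y 0) (X (suc m)) (X′ (suc m))
    (+-cancelʳ ((shift Y ⊛ X) m) _ _
      (trans (YX≈YX′ (suc m))
             (cong (_+_ (Y 0 * X′ (suc m))) (⊛-agree m (λ _ _ → refl) (λ k k<1+m → sym (X≈ k k<1+m))))))

-- Fixed points of x ↦ z·Φ(x): if Φ never lowers the degree up to which two
-- series agree, iterating from 0 stabilises degree by degree, and the
-- diagonal of the iterates is a fixed point.
module FixedPoint (Φ : Series → Series)
                  (Φ-agree : ∀ {L x y} → Agree L x y → Agree L (Φ x) (Φ y)) where

  iterate : ℕ → Series
  iterate zero    = 0ₛ
  iterate (suc k) = zₛ *ₛ Φ (iterate k)

  iterate-stable : ∀ j k → Agree k (iterate (k ℕ.+ j)) (iterate k)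
  iterate-stable j zero    _ ()
  iterate-stable j (suc k) = z*-agree (Φ-agree (iterate-stable j k))

  fix : Series
  fix n = iterate (suc n) n

  fix-agree : ∀ n → Agree n fix (iterate n)
  fix-agree n k k<n = begin
    iterate (suc k) k                   ≡⟨ sym (iterate-stable (n ∸ suc k) (suc k) k ℕₚ.≤-refl) ⟩
    iterate (suc k ℕ.+ (n ∸ suc k)) k   ≡⟨ cong (λ m → iterate m k) (ℕₚ.m+[n∸m]≡n k<n) ⟩
    iterate n k                         ∎
    where open ≡-Reasoning

  fix-equation : zₛ *ₛ Φ fix ≈ₛ fix
  fix-equation n = z*-agree (Φ-agree (fix-agree n)) n ℕₚ.≤-refl

module V̂ = FixedPoint (λ x → const (+ 1) +ₛ x +ₛ x *ₛ x)
                      (λ x≈y → +ₛ-agree (+ₛ-agree {f = const (+ 1)} (λ _ _ → refl) x≈y) (*ₛ-agree x≈y x≈y))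
v̂ : Series
v̂ = V̂.fix

module ≈ₛ-Reasoning = SetoidReasoning (CommutativeRing.setoid seriesRing)

-- Congruences; the unchanged operand is explicit because it cannot be
-- inferred from a proof of _≈ₛ_.
+ₛ-cong : ∀ {f f′ g g′} → f ≈ₛ f′ → g ≈ₛ g′ → f +ₛ g ≈ₛ f′ +ₛ g′
+ₛ-cong f≈ g≈ n = cong₂ _+_ (f≈ n) (g≈ n)

+ₛ-congˡ : ∀ h {f g} → f ≈ₛ g → h +ₛ f ≈ₛ h +ₛ g
+ₛ-congˡ h = +ₛ-cong (≈ₛ-refl {h})

+ₛ-congʳ : ∀ h {f g} → f ≈ₛ g → f +ₛ h ≈ₛ g +ₛ h
+ₛ-congʳ h f≈g = +ₛ-cong f≈g (≈ₛ-refl {h})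

-ₛ-cong : ∀ {f f′ g g′} → f ≈ₛ f′ → g ≈ₛ g′ → f -ₛ g ≈ₛ f′ -ₛ g′
-ₛ-cong f≈ g≈ n = cong₂ _-_ (f≈ n) (g≈ n)

-ₛ-congˡ : ∀ h {f g} → f ≈ₛ g → h -ₛ f ≈ₛ h -ₛ g
-ₛ-congˡ h = -ₛ-cong (≈ₛ-refl {h})

-ₛ-congʳ : ∀ h {f g} → f ≈ₛ g → f -ₛ h ≈ₛ g -ₛ h
-ₛ-congʳ h f≈g = -ₛ-cong f≈g (≈ₛ-refl {h})

*ₛ-congˡ : ∀ h {f g} → f ≈ₛ g → h *ₛ f ≈ₛ h *ₛ g
*ₛ-congˡ h = *ₛ-cong (≈ₛ-refl {h})

*ₛ-congʳ : ∀ h {f g} → f ≈ₛ g → f *ₛ h ≈ₛ g *ₛ h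
*ₛ-congʳ h f≈g = *ₛ-cong f≈g (≈ₛ-refl {h})

byCertificate : ∀ {e e′} → e ≈ₛ e′ → ∀ {L R} K → L ≈ₛ R +ₛ K *ₛ (e -ₛ e′) → L ≈ₛ R
byCertificate {e} {e′} e≈e′ {L} {R} K L≈ = begin
  L                      ≈⟨ L≈ ⟩
  R +ₛ K *ₛ (e -ₛ e′)   ≈⟨ +ₛ-congˡ R (*ₛ-congˡ K (-ₛ-congˡ e (≈ₛ-sym e≈e′))) ⟩
  R +ₛ K *ₛ (e -ₛ e)    ≈⟨ solve 3 (λ r k x → r :+ k :* (x :- x) := r) ≈ₛ-refl R K e ⟩
  R                      ∎
  where open ≈ₛ-Reasoning

-- Two square roots with constant term 1 of the same series coincide:
-- (S − T)(S + T) = 0 and S + T has constant term 2.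
sqrt-unique : ∀ {S T} → S 0 ≡ + 1 → T 0 ≡ + 1 → S *ₛ S ≈ₛ T *ₛ T → S ≈ₛ T
sqrt-unique {S} {T} S₀≡1 T₀≡1 S²≈T² n =
  ℤₚ.i-j≡0⇒i≡j (S n) (T n) (*ₛ-cancelʳ {S -ₛ T} {0ₛ} (S +ₛ T) sum₀≢0 product≈0 n)
  where
  open ≈ₛ-Reasoning
  product≈0 : (S -ₛ T) *ₛ (S +ₛ T) ≈ₛ 0ₛ *ₛ (S +ₛ T)
  product≈0 = begin
    (S -ₛ T) *ₛ (S +ₛ T)          ≈⟨ solve 2 (λ s t → (s :- t) :* (s :+ t) := s :* s :- t :* t) ≈ₛ-refl S T ⟩
    S *ₛ S -ₛ T *ₛ T               ≈⟨ -ₛ-congʳ (T *ₛ T) S²≈T² ⟩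
    T *ₛ T -ₛ T *ₛ T               ≈⟨ solve 2 (λ s t → t :* t :- t :* t := con (+ 0) :* (s :+ t)) ≈ₛ-refl S T ⟩
    const (+ 0) *ₛ (S +ₛ T)       ≈⟨ *ₛ-congʳ (S +ₛ T) const0 ⟩
    0ₛ *ₛ (S +ₛ T)                 ∎
  sum₀≢0 : ¬ (S 0 + T 0 ≡ + 0)
  sum₀≢0 eq with trans (sym (cong₂ _+_ S₀≡1 T₀≡1)) eq
  ... | ()

sumₛ : ℕ → (ℕ → Series) → Series
sumₛ zero    F = const (+ 0)
sumₛ (suc h) F = sumₛ h F +ₛ F h

sumₛ-agree : ∀ h {L F F′} → (∀ k → Agree L (F k) (F′ k)) → Agree L (sumₛ h F) (sumₛ h F′)
sumₛ-agree zero    F≈ k _   = refl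
sumₛ-agree (suc h) F≈     = +ₛ-agree (sumₛ-agree h F≈) (F≈ h)

sumₛ-scale : ∀ h W F → W *ₛ sumₛ h F ≈ₛ sumₛ h (λ k → W *ₛ F k)
sumₛ-scale zero    W F = solve 1 (λ w → w :* con (+ 0) := con (+ 0)) ≈ₛ-refl W
sumₛ-scale (suc h) W F =
  ≈ₛ-trans (solve 3 (λ w s f → w :* (s :+ f) := w :* s :+ w :* f) ≈ₛ-refl W (sumₛ h F) (F h))
           (+ₛ-congʳ (W *ₛ F h) (sumₛ-scale h W F))

sumₛ-sub : ∀ h F F′ → sumₛ h F -ₛ sumₛ h F′ ≈ₛ sumₛ h (λ k → F k -ₛ F′ k)
sumₛ-sub zero    F F′ = solve 0 (con (+ 0) :- con (+ 0) := con (+ 0)) ≈ₛ-refl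
sumₛ-sub (suc h) F F′ =
  ≈ₛ-trans (solve 4 (λ s f s′ f′ → (s :+ f) :- (s′ :+ f′) := (s :- s′) :+ (f :- f′)) ≈ₛ-refl
                    (sumₛ h F) (F h) (sumₛ h F′) (F′ h))
           (+ₛ-congʳ (F h -ₛ F′ h) (sumₛ-sub h F F′))

pow : Series → ℕ → Series
pow x zero    = const (+ 1)
pow x (suc m) = x *ₛ pow x m

τ : Series
τ = const (+ 1) +ₛ zₛ

β : Series
β = const (+ 2) +ₛ const (+ 2) *ₛ zₛ +ₛ zₛ *ₛ zₛ

-- zu₁ v = 1 − z v; for v = v̂ this is z u₁ = (1 + z + √(1 − 2z − 3z²))/2.
zu₁ : Series → Series
zu₁ v = const (+ 1) -ₛ zₛ *ₛ v

VEquation : Series → Set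
VEquation v = zₛ *ₛ (const (+ 1) +ₛ v +ₛ v *ₛ v) ≈ₛ v

v̂-equation : VEquation v̂
v̂-equation = V̂.fix-equation

-- Each identity below holds modulo the functional equation of v; the
-- certificate is the multiple of z(1 + v + v²) − v by which its sides differ.
module _ {v : Series} (eqn : VEquation v) where

  β-factorisation : (τ +ₛ zₛ *ₛ v) *ₛ (const (+ 2) -ₛ zₛ *ₛ v) ≈ₛ β
  β-factorisation = byCertificate eqn (negₛ zₛ)
    (solve 2 (λ z v → (con (+ 1) :+ z :+ z :* v) :* (con (+ 2) :- z :* v)
                   := (con (+ 2) :+ con (+ 2) :* z :+ z :* z)
                      :+ (:- z) :* (z :* (con (+ 1) :+ v :+ v :* v) :- v))
           ≈ₛ-refl zₛ v)

  square-identity : (τ +ₛ zₛ *ₛ v) *ₛ ((const (+ 1) +ₛ v) *ₛ (const (+ 1) +ₛ v))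
                    ≈ₛ (const (+ 1) +ₛ const (+ 2) *ₛ v +ₛ const (+ 2) *ₛ v *ₛ v) *ₛ τ
  square-identity = byCertificate eqn v
    (solve 2 (λ z v → (con (+ 1) :+ z :+ z :* v) :* ((con (+ 1) :+ v) :* (con (+ 1) :+ v))
                   := (con (+ 1) :+ con (+ 2) :* v :+ con (+ 2) :* v :* v) :* (con (+ 1) :+ z)
                      :+ v :* (z :* (con (+ 1) :+ v :+ v :* v) :- v))
           ≈ₛ-refl zₛ v)

  sqrt-identity : (const (+ 1) -ₛ zₛ -ₛ const (+ 2) *ₛ zₛ *ₛ v) *ₛ (const (+ 1) -ₛ zₛ -ₛ const (+ 2) *ₛ zₛ *ₛ v)
                  ≈ₛ const (+ 1) -ₛ const (+ 2) *ₛ zₛ -ₛ const (+ 3) *ₛ zₛ *ₛ zₛ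
  sqrt-identity = byCertificate eqn (const (+ 4) *ₛ zₛ)
    (solve 2 (λ z v → (con (+ 1) :- z :- con (+ 2) :* z :* v) :* (con (+ 1) :- z :- con (+ 2) :* z :* v)
                   := (con (+ 1) :- con (+ 2) :* z :- con (+ 3) :* z :* z)
                      :+ con (+ 4) :* z :* (z :* (con (+ 1) :+ v :+ v :* v) :- v))
           ≈ₛ-refl zₛ v)

  cf-identity : (τ +ₛ zₛ *ₛ v) *ₛ (zu₁ v *ₛ zu₁ v -ₛ (zₛ *ₛ τ) *ₛ (zₛ *ₛ τ) -ₛ zₛ *ₛ zₛ *ₛ (zu₁ v *ₛ zu₁ v))
                ≈ₛ τ *ₛ (zu₁ v *ₛ zu₁ v -ₛ (zₛ *ₛ τ) *ₛ (zₛ *ₛ τ))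
  cf-identity = byCertificate eqn (zₛ *ₛ zₛ *ₛ v -ₛ zₛ *ₛ zₛ *ₛ zₛ *ₛ zₛ *ₛ v -ₛ zₛ *ₛ zₛ -ₛ zₛ)
    (solve 2 (λ z v → let u = con (+ 1) :- z :* v ; t = con (+ 1) :+ z in
                 (t :+ z :* v) :* (u :* u :- (z :* t) :* (z :* t) :- z :* z :* (u :* u))
              := t :* (u :* u :- (z :* t) :* (z :* t))
                 :+ (z :* z :* v :- z :* z :* z :* z :* v :- z :* z :- z) :* (z :* (con (+ 1) :+ v :+ v :* v) :- v))
           ≈ₛ-refl zₛ v)

-- Counting paths by their first step

module Counting where
  open import Data.Nat using (_<ᵇ_)
  open import Data.Bool as Bool using (Bool)
  open import Data.Product using (Σ; proj₁; proj₂)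
  open import Data.Sum using (_⊎_)
  open import Data.Sum.Function.Propositional using (_⊎-↔_)
  open import Data.Fin.Properties using (+↔⊎; 1↔⊤)
  open import Data.Fin.Permutation using (↔⇒≡)
  open import Function.Bundles using (mk↔ₛ′)
  open import Function.Properties.Inverse using (↔-trans; ↔-sym)
  open import Axiom.UniquenessOfIdentityProofs using (module Decidable⇒UIP)

  -- Validity proofs are unique, so a path is determined by its steps.
  bool-irrelevant : ∀ {a b : Bool} (p q : a ≡ b) → p ≡ q
  bool-irrelevant = Decidable⇒UIP.≡-irrelevant Bool._≟_

  Paths : ℕ → Maybe ℕ → ℕ → Set
  Paths h r L = Σ (List Step) λ p → (length p ≡ L) × (valid h r p ≡ true)

  paths-≡ : ∀ {h r L} {x y : Paths h r L} → proj₁ x ≡ proj₁ y → x ≡ y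
  paths-≡ {x = p , l , v} {.p , l′ , v′} refl =
    cong₂ (λ l v → p , l , v) (ℕₚ.≡-irrelevant l l′) (bool-irrelevant v v′)

  afterDown : ℕ → Maybe ℕ → Maybe ℕ
  afterDown h nothing  = just h
  afterDown h (just s) = just s

  valid-down : ∀ h r j p →
    valid h r (down j ∷ p) ≡ ((j <ᵇ h) ∧ valid (h ∸ suc j) (afterDown h r) p)
  valid-down h nothing  j p = refl
  valid-down h (just s) j p = refl

  ∧-split : ∀ {a b} → (a ∧ b) ≡ true → (a ≡ true) × (b ≡ true)
  ∧-split {true} {true} refl = refl , refl

  sumBelow : ℕ → (ℕ → ℕ) → ℕ
  sumBelow zero    f = 0
  sumBelow (suc h) f = f 0 ℕ.+ sumBelow h (f ∘ suc)

  BelowΣ : ℕ → (ℕ → Set) → Set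
  BelowΣ h B = Σ ℕ λ j → ((j <ᵇ h) ≡ true) × B j

  count : ℕ → Maybe ℕ → ℕ → ℕ
  count h r zero    = if valid h r [] then 1 else 0
  count h r (suc L) = (if runOK r h then count (suc h) nothing L else 0)
                      ℕ.+ sumBelow h (λ j → count (h ∸ suc j) (afterDown h r) L)

  Fin-if : ∀ b {n} {A : Set} → Fin n ↔ A → Fin (if b then n else 0) ↔ ((b ≡ true) × A)
  Fin-if true  e = ↔-trans e (mk↔ₛ′ (refl ,_) proj₂ (λ { (refl , _) → refl }) (λ _ → refl))
  Fin-if false e = mk↔ₛ′ (λ ()) (λ { (() , _) }) (λ { (() , _) }) (λ ())

  Fin-sumBelow : ∀ h {f : ℕ → ℕ} {B : ℕ → Set} → (∀ j → Fin (f j) ↔ B j) → Fin (sumBelow h f) ↔ BelowΣ h B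
  Fin-sumBelow zero    e = mk↔ₛ′ (λ ()) (λ { (_ , () , _) }) (λ { (_ , () , _) }) (λ ())
  Fin-sumBelow (suc h) {B = B} e =
    ↔-trans +↔⊎ (↔-trans (e 0 ⊎-↔ Fin-sumBelow h (e ∘ suc)) (mk↔ₛ′ join split join-split split-join))
    where
    join : B 0 ⊎ BelowΣ h (B ∘ suc) → BelowΣ (suc h) B
    join (inj₁ b)             = zero , refl , b
    join (inj₂ (j , j<h , b)) = suc j , j<h , b
    split : BelowΣ (suc h) B → B 0 ⊎ BelowΣ h (B ∘ suc)
    split (zero  , _ , b)   = inj₁ b
    split (suc j , j<h , b) = inj₂ (j , j<h , b)
    join-split : ∀ x → join (split x) ≡ x
    join-split (zero  , refl , b) = refl
    join-split (suc j , _ , b)    = refl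
    split-join : ∀ y → split (join y) ≡ y
    split-join (inj₁ b) = refl
    split-join (inj₂ _) = refl

  paths-nil : ∀ h r → Paths h r 0 ↔ ((valid h r [] ≡ true) × ⊤)
  paths-nil h r = mk↔ₛ′ (λ { ([] , _ , v) → v , tt }) (λ { (v , tt) → [] , refl , v })
                        (λ _ → refl) (λ { ([] , refl , v) → refl })

  paths-cons : ∀ h r L → Paths h r (suc L) ↔
    (((runOK r h ≡ true) × Paths (suc h) nothing L) ⊎ BelowΣ h (λ j → Paths (h ∸ suc j) (afterDown h r) L))
  paths-cons h r L = mk↔ₛ′ to from to-from from-to
    where
    to : Paths h r (suc L) → _
    to (up ∷ p , len , v)     = inj₁ (proj₁ (∧-split v) , p , ℕₚ.suc-injective len , proj₂ (∧-split v))
    to (down j ∷ p , len , v) = inj₂ (j , proj₁ s , p , ℕₚ.suc-injective len , proj₂ s)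
      where s = ∧-split (trans (sym (valid-down h r j p)) v)
    from : _ → Paths h r (suc L)
    from (inj₁ (ok , p , len , v))      = up ∷ p , cong suc len , cong₂ _∧_ ok v
    from (inj₂ (j , j<h , p , len , v)) =
      down j ∷ p , cong suc len , trans (valid-down h r j p) (cong₂ _∧_ j<h v)
    to-from : ∀ y → to (from y) ≡ y
    to-from (inj₁ (ok , x))      =
      cong inj₁ (cong₂ _,_ (bool-irrelevant _ ok) (paths-≡ refl))
    to-from (inj₂ (j , j<h , x)) =
      cong (λ q → inj₂ (j , q)) (cong₂ _,_ (bool-irrelevant _ j<h) (paths-≡ refl))
    from-to : ∀ x → from (to x) ≡ x
    from-to (up ∷ p , _)     = paths-≡ refl
    from-to (down j ∷ p , _) = paths-≡ refl

  count-paths : ∀ L h r → Fin (count h r L) ↔ Paths h r L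
  count-paths zero    h r = ↔-trans (Fin-if (valid h r []) 1↔⊤) (↔-sym (paths-nil h r))
  count-paths (suc L) h r =
    ↔-trans +↔⊎ (↔-trans (Fin-if (runOK r h) (count-paths L (suc h) nothing)
                           ⊎-↔ Fin-sumBelow h (λ j → count-paths L (h ∸ suc j) (afterDown h r)))
                         (↔-sym (paths-cons h r L)))

  count-correct : (a : ℕ → ℕ) → ((n : ℕ) → Fin (a n) ↔ GoodPaths n) → ∀ n → a n ≡ count 0 nothing n
  count-correct a enum n = ↔⇒≡ (↔-trans (enum n) (↔-sym (count-paths n 0 nothing)))

-- A linear system with a unique solution

record Solves (G : ℕ → Series) (c : Series) (Y : ℕ → Series) (Ψ : Series) : Set where
  field
    base : Y 0 ≈ₛ const (+ 0)
    head : Ψ ≈ₛ c +ₛ zₛ *ₛ (Y 1 +ₛ G 0 *ₛ Ψ)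
    tail : ∀ m → Y (suc m) ≈ₛ zₛ *ₛ (Y (suc (suc m)) +ₛ G (suc m) *ₛ Ψ +ₛ sumₛ (suc m) Y)

-- Every right-hand side is a multiple of z, so each coefficient of a
-- solution is determined by lower ones: the solution is unique.
solution-unique : ∀ {G c Y Y′ Ψ Ψ′} → Solves G c Y Ψ → Solves G c Y′ Ψ′ → Ψ ≈ₛ Ψ′
solution-unique {G} {c} {Y} {Y′} {Ψ} {Ψ′} sol sol′ = coefficientInduction {I = Maybe ℕ} {X} {X′} step nothing
  where
  module S  = Solves sol
  module S′ = Solves sol′
  X X′ : Maybe ℕ → Series
  X nothing   = Ψ
  X (just h)  = Y h
  X′ nothing  = Ψ′
  X′ (just h) = Y′ h
  step : ∀ L → (∀ i → Agree L (X i) (X′ i)) → ∀ i → X i L ≡ X′ i L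
  step L agree nothing        = trans (S.head L) (trans (cong (_+_ (c L)) (z*-agree
    (+ₛ-agree (agree (just 1)) (*ₛ-agree {f = G 0} (λ _ _ → refl) (agree nothing))) L ℕₚ.≤-refl))
    (sym (S′.head L)))
  step L agree (just zero)    = trans (S.base L) (sym (S′.base L))
  step L agree (just (suc m)) = trans (S.tail m L) (trans (z*-agree
    (+ₛ-agree (+ₛ-agree (agree (just (suc (suc m)))) (*ₛ-agree {f = G (suc m)} (λ _ _ → refl) (agree nothing)))
              (sumₛ-agree (suc m) (agree ∘ just))) L ℕₚ.≤-refl)
    (sym (S′.tail m L)))

solution-scale : ∀ {G c Y Ψ} W → Solves G c Y Ψ → Solves G (W *ₛ c) (λ h → W *ₛ Y h) (W *ₛ Ψ)
solution-scale {G} {c} {Y} {Ψ} W sol = record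
  { base = ≈ₛ-trans (*ₛ-congˡ W S.base) (solve 1 (λ w → w :* con (+ 0) := con (+ 0)) ≈ₛ-refl W)
  ; head = ≈ₛ-trans (*ₛ-congˡ W S.head)
      (solve 6 (λ w c z y g p → w :* (c :+ z :* (y :+ g :* p)) := w :* c :+ z :* (w :* y :+ g :* (w :* p)))
             ≈ₛ-refl W c zₛ (Y 1) (G 0) Ψ)
  ; tail = λ m → ≈ₛ-trans (*ₛ-congˡ W (S.tail m)) (≈ₛ-trans
      (solve 6 (λ w z y g p s → w :* (z :* (y :+ g :* p :+ s)) := z :* (w :* y :+ g :* (w :* p) :+ w :* s))
             ≈ₛ-refl W zₛ (Y (suc (suc m))) (G (suc m)) Ψ (sumₛ (suc m) Y))
      (*ₛ-congˡ zₛ (+ₛ-congˡ (W *ₛ Y (suc (suc m)) +ₛ G (suc m) *ₛ (W *ₛ Ψ)) (sumₛ-scale (suc m) W Y))))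
  }
  where module S = Solves sol

-- Starting above the axis, a path
-- behaves as if a run had begun at the starting level, so F (m+1) is
-- O (m+1) or E (m+1) according to the parity of m + 1; as O − E at height
-- m + 1 is z τ^m F₀, this gives F (m+1) = E (m+1) + G m F₀.
G : ℕ → Series
G m = if oddᵇ (suc m) then zₛ *ₛ pow τ m else const (+ 0)

-- Averaging over the sign removes the parity condition: 2 G m = z(τ^m + (−τ)^m).
twice-G : ∀ m → const (+ 2) *ₛ G m ≈ₛ zₛ *ₛ (pow τ m +ₛ pow (negₛ τ) m)
twice-G zero          = solve 1 (λ z → con (+ 2) :* (z :* con (+ 1)) := z :* (con (+ 1) :+ con (+ 1))) ≈ₛ-refl zₛ
twice-G (suc zero)    = solve 1 (λ z → con (+ 2) :* con (+ 0)
                                     := z :* ((con (+ 1) :+ z) :* con (+ 1) :+ (:- (con (+ 1) :+ z)) :* con (+ 1)))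
                                ≈ₛ-refl zₛ
twice-G (suc (suc m)) = begin
  const (+ 2) *ₛ G (suc (suc m))             ≈⟨ *ₛ-congˡ (const (+ 2)) (G-shift (oddᵇ (suc m))) ⟩
  const (+ 2) *ₛ (τ *ₛ τ *ₛ G m)             ≈⟨ solve 3 (λ z t g → con (+ 2) :* (t :* t :* g) := t :* t :* (con (+ 2) :* g))
                                                         ≈ₛ-refl zₛ τ (G m) ⟩
  τ *ₛ τ *ₛ (const (+ 2) *ₛ G m)             ≈⟨ *ₛ-congˡ (τ *ₛ τ) (twice-G m) ⟩
  τ *ₛ τ *ₛ (zₛ *ₛ (pow τ m +ₛ pow (negₛ τ) m))
    ≈⟨ solve 3 (λ z b c → (con (+ 1) :+ z) :* (con (+ 1) :+ z) :* (z :* (b :+ c))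
                        := z :* ((con (+ 1) :+ z) :* ((con (+ 1) :+ z) :* b)
                                 :+ (:- (con (+ 1) :+ z)) :* ((:- (con (+ 1) :+ z)) :* c)))
             ≈ₛ-refl zₛ (pow τ m) (pow (negₛ τ) m) ⟩
  zₛ *ₛ (pow τ (suc (suc m)) +ₛ pow (negₛ τ) (suc (suc m))) ∎
  where
  open ≈ₛ-Reasoning
  G-shift : ∀ b → (if b then zₛ *ₛ pow τ (suc (suc m)) else const (+ 0))
                  ≈ₛ τ *ₛ τ *ₛ (if b then zₛ *ₛ pow τ m else const (+ 0))
  G-shift true  = solve 3 (λ z t p → z :* (t :* (t :* p)) := t :* t :* (z :* p)) ≈ₛ-refl zₛ τ (pow τ m)
  G-shift false = solve 1 (λ t → con (+ 0) := t :* t :* con (+ 0)) ≈ₛ-refl τ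

module GeneratingFunctions where
  open Counting
  open import Data.Nat using (_≡ᵇ_)

  C : ℕ → Maybe ℕ → Series
  C h r L = + count h r L

  sumₛ-C : ∀ h r L → sumₛ h (λ k → C k r) L ≡ + sumBelow h (λ j → count (h ∸ suc j) r L)
  sumₛ-C zero    r L = const0 L
  sumₛ-C (suc h) r L = begin
    sumₛ h (λ k → C k r) L + + count h r L
      ≡⟨ cong (_+ + count h r L) (sumₛ-C h r L) ⟩
    + S + + count h r L      ≡⟨ ℤₚ.+-comm (+ S) (+ count h r L) ⟩
    + count h r L + + S      ≡⟨ sym (ℤₚ.pos-+ (count h r L) S) ⟩
    + (count h r L ℕ.+ S)    ∎
    where
    open ≡-Reasoning
    S = sumBelow h (λ j → count (h ∸ suc j) r L)

  ifₛ-C : ∀ b h r L → (if b then C h r else const (+ 0)) L ≡ + (if b then count h r L else 0)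
  ifₛ-C true  h r L       = refl
  ifₛ-C false h r zero    = refl
  ifₛ-C false h r (suc L) = refl

  upPart downPart : ℕ → Maybe ℕ → Series
  upPart   h r = if runOK r h then C (suc h) nothing else const (+ 0)
  downPart h r = sumₛ h (λ k → C k (afterDown h r))

  C-equation : ∀ h r → C h r ≈ₛ const (+ count h r 0) +ₛ zₛ *ₛ (upPart h r +ₛ downPart h r)
  C-equation h r zero    =
    sym (trans (cong (_+_ (+ count h r 0)) (z*-zero (upPart h r +ₛ downPart h r))) (ℤₚ.+-identityʳ _))
  C-equation h r (suc L) = sym (begin
    + 0 + (zₛ *ₛ (upPart h r +ₛ downPart h r)) (suc L)  ≡⟨ ℤₚ.+-identityˡ _ ⟩
    (zₛ *ₛ (upPart h r +ₛ downPart h r)) (suc L)        ≡⟨ z*-suc (upPart h r +ₛ downPart h r) L ⟩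
    upPart h r L + downPart h r L
      ≡⟨ cong₂ _+_ (ifₛ-C (runOK r h) (suc h) nothing L) (sumₛ-C h (afterDown h r) L) ⟩
    + upCount + + downCount                             ≡⟨ sym (ℤₚ.pos-+ upCount downCount) ⟩
    + count h r (suc L)                                 ∎)
    where
    open ≡-Reasoning
    upCount downCount : ℕ
    upCount   = if runOK r h then count (suc h) nothing L else 0
    downCount = sumBelow h (λ j → count (h ∸ suc j) (afterDown h r) L)

  count-parity : ∀ L h {s s′} → oddᵇ s ≡ oddᵇ s′ → count h (just s) L ≡ count h (just s′) L
  count-parity zero    h odd = cong (λ b → if (h ≡ᵇ 0) ∧ (if h ≡ᵇ 0 then b else true) then 1 else 0) odd
  count-parity (suc L) h odd =
    cong₂ ℕ._+_ (cong (λ b → if (if h ≡ᵇ 0 then b else true) then count (suc h) nothing L else 0) odd)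
                (sumBelow-cong h (λ j → count-parity L (h ∸ suc j) odd))
    where
    sumBelow-cong : ∀ h {f g} → (∀ j → f j ≡ g j) → sumBelow h f ≡ sumBelow h g
    sumBelow-cong zero    f≡g = refl
    sumBelow-cong (suc h) f≡g = cong₂ ℕ._+_ (f≡g 0) (sumBelow-cong h (f≡g ∘ suc))

  -- F h: no run pending; O h, E h: a run started at an odd, resp. even, level
  -- is pending.  A = F 0 is the generating function of the theorem.
  F O E : ℕ → Series
  F h = C h nothing
  O h = C h (just 1)
  E h = C h (just 0)

  -- Above the axis, starting with no pending run is the same as starting
  -- with a run begun at the current level (the next down-step begins it).
  count-start : ∀ m L → count (suc m) nothing L ≡ count (suc m) (just (suc m)) L
  count-start m zero    = refl
  count-start m (suc L) = refl

  F-pos : ∀ m → F (suc m) ≈ₛ (if oddᵇ (suc m) then O (suc m) else E (suc m))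
  F-pos m L with oddᵇ (suc m) in odd
  ... | true  = cong +_ (trans (count-start m L) (count-parity L (suc m) odd))
  ... | false = cong +_ (trans (count-start m L) (count-parity L (suc m) odd))

  -- On the axis a run begun at an odd level may end, so it imposes nothing.
  O-zero : O 0 ≈ₛ F 0
  O-zero zero    = refl
  O-zero (suc L) = refl

  -- A run ending on the axis that started at an even level is forbidden.
  E-zero : E 0 ≈ₛ const (+ 0)
  E-zero zero    = refl
  E-zero (suc L) = refl

  -- O and E satisfy the same equation up to their values at height 0, so
  -- Σ_{k≤m} (O k − E k) = τ^m F₀ and O (m+1) − E (m+1) = z τ^m F₀.
  O-E-sum  : ∀ m → sumₛ (suc m) (λ k → O k -ₛ E k) ≈ₛ pow τ m *ₛ F 0
  O-E-step : ∀ m → O (suc m) -ₛ E (suc m) ≈ₛ zₛ *ₛ (pow τ m *ₛ F 0)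

  O-E-sum zero = begin
    const (+ 0) +ₛ (O 0 -ₛ E 0)        ≈⟨ +ₛ-congˡ (const (+ 0)) (-ₛ-cong O-zero E-zero) ⟩
    const (+ 0) +ₛ (F 0 -ₛ const (+ 0)) ≈⟨ solve 1 (λ f → con (+ 0) :+ (f :- con (+ 0)) := con (+ 1) :* f) ≈ₛ-refl (F 0) ⟩
    const (+ 1) *ₛ F 0                  ∎
    where open ≈ₛ-Reasoning
  O-E-sum (suc m) = begin
    sumₛ (suc m) (λ k → O k -ₛ E k) +ₛ (O (suc m) -ₛ E (suc m))
      ≈⟨ +ₛ-cong (O-E-sum m) (O-E-step m) ⟩
    pow τ m *ₛ F 0 +ₛ zₛ *ₛ (pow τ m *ₛ F 0)
      ≈⟨ solve 3 (λ z p f → p :* f :+ z :* (p :* f) := (con (+ 1) :+ z) :* p :* f) ≈ₛ-refl zₛ (pow τ m) (F 0) ⟩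
    pow τ (suc m) *ₛ F 0 ∎
    where open ≈ₛ-Reasoning

  O-E-step m = begin
    O (suc m) -ₛ E (suc m)
      ≈⟨ -ₛ-cong (C-equation (suc m) (just 1)) (C-equation (suc m) (just 0)) ⟩
    (const (+ 0) +ₛ zₛ *ₛ (F (suc (suc m)) +ₛ sumₛ (suc m) O))
      -ₛ (const (+ 0) +ₛ zₛ *ₛ (F (suc (suc m)) +ₛ sumₛ (suc m) E))
      ≈⟨ solve 4 (λ z f o e → (con (+ 0) :+ z :* (f :+ o)) :- (con (+ 0) :+ z :* (f :+ e)) := z :* (o :- e))
               ≈ₛ-refl zₛ (F (suc (suc m))) (sumₛ (suc m) O) (sumₛ (suc m) E) ⟩
    zₛ *ₛ (sumₛ (suc m) O -ₛ sumₛ (suc m) E)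
      ≈⟨ *ₛ-congˡ zₛ (≈ₛ-trans (sumₛ-sub (suc m) O E) (O-E-sum m)) ⟩
    zₛ *ₛ (pow τ m *ₛ F 0) ∎
    where open ≈ₛ-Reasoning

  F-step : ∀ m → F (suc m) ≈ₛ E (suc m) +ₛ G m *ₛ F 0
  F-step m = byParity (oddᵇ (suc m)) (F-pos m)
    where
    byParity : ∀ b → F (suc m) ≈ₛ (if b then O (suc m) else E (suc m)) →
               F (suc m) ≈ₛ E (suc m) +ₛ (if b then zₛ *ₛ pow τ m else const (+ 0)) *ₛ F 0
    byParity true  F≈O = ≈ₛ-trans F≈O (begin
      O (suc m)                               ≈⟨ solve 2 (λ o e → o := e :+ (o :- e)) ≈ₛ-refl (O (suc m)) (E (suc m)) ⟩
      E (suc m) +ₛ (O (suc m) -ₛ E (suc m))   ≈⟨ +ₛ-congˡ (E (suc m)) (O-E-step m) ⟩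
      E (suc m) +ₛ zₛ *ₛ (pow τ m *ₛ F 0)     ≈⟨ solve 4 (λ e z p f → e :+ z :* (p :* f) := e :+ z :* p :* f)
                                                        ≈ₛ-refl (E (suc m)) zₛ (pow τ m) (F 0) ⟩
      E (suc m) +ₛ zₛ *ₛ pow τ m *ₛ F 0       ∎)
      where open ≈ₛ-Reasoning
    byParity false F≈E =
      ≈ₛ-trans F≈E (solve 2 (λ e f → e := e :+ con (+ 0) :* f) ≈ₛ-refl (E (suc m)) (F 0))

  pathSolution : Solves G (const (+ 1)) E (F 0)
  pathSolution = record
    { base = E-zero
    ; head = begin
        F 0                                        ≈⟨ C-equation 0 nothing ⟩
        const (+ 1) +ₛ zₛ *ₛ (F 1 +ₛ const (+ 0))
          ≈⟨ +ₛ-congˡ (const (+ 1)) (*ₛ-congˡ zₛ (+ₛ-congʳ (const (+ 0)) (F-step 0))) ⟩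
        const (+ 1) +ₛ zₛ *ₛ (E 1 +ₛ G 0 *ₛ F 0 +ₛ const (+ 0))
          ≈⟨ +ₛ-congˡ (const (+ 1)) (*ₛ-congˡ zₛ (solve 1 (λ x → x :+ con (+ 0) := x) ≈ₛ-refl (E 1 +ₛ G 0 *ₛ F 0))) ⟩
        const (+ 1) +ₛ zₛ *ₛ (E 1 +ₛ G 0 *ₛ F 0)  ∎
    ; tail = λ m → begin
        E (suc m)                                  ≈⟨ C-equation (suc m) (just 0) ⟩
        const (+ 0) +ₛ zₛ *ₛ (F (suc (suc m)) +ₛ sumₛ (suc m) E)
          ≈⟨ +ₛ-congˡ (const (+ 0)) (*ₛ-congˡ zₛ (+ₛ-congʳ (sumₛ (suc m) E) (F-step (suc m)))) ⟩
        const (+ 0) +ₛ zₛ *ₛ (E (suc (suc m)) +ₛ G (suc m) *ₛ F 0 +ₛ sumₛ (suc m) E)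
          ≈⟨ solve 2 (λ z x → con (+ 0) :+ z :* x := z :* x) ≈ₛ-refl zₛ (E (suc (suc m)) +ₛ G (suc m) *ₛ F 0 +ₛ sumₛ (suc m) E) ⟩
        zₛ *ₛ (E (suc (suc m)) +ₛ G (suc m) *ₛ F 0 +ₛ sumₛ (suc m) E) ∎
    }
    where open ≈ₛ-Reasoning

-- An explicit solution of the system

-- For v with v = z(1 + v + v²), the forcing term W = 2τ(2 − zv) admits a
-- solution whose components are combinations of the geometric sequences
-- (1 + v)^h, τ^h and (−τ)^h, with Ψ = Φ = 2β.
module ExplicitSolution {v : Series} (eqn : VEquation v) where
  open SeriesSolver using (Polynomial)

  W Φ : Series
  W = const (+ 2) *ₛ τ *ₛ (const (+ 2) -ₛ zₛ *ₛ v)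
  Φ = const (+ 2) *ₛ β

  X : ℕ → Series
  X zero    = const (+ 0)
  X (suc m) = const (+ 2) *ₛ τ *ₛ v *ₛ pow (const (+ 1) +ₛ v) m
              -ₛ zₛ *ₛ β *ₛ pow τ m
              -ₛ zₛ *ₛ zₛ *ₛ (const (+ 2) +ₛ zₛ) *ₛ pow (negₛ τ) m

  -- Solver syntax for these series in the atoms z, v, a = (1+v)^m,
  -- b = τ^m and c = (−τ)^m.
  τᵖ βᵖ : ∀ {n} → Polynomial n → Polynomial n
  τᵖ z = con (+ 1) :+ z
  βᵖ z = con (+ 2) :+ con (+ 2) :* z :+ z :* z

  Xᵖ : ∀ {n} (z v a b c : Polynomial n) → Polynomial n
  Xᵖ z v a b c = con (+ 2) :* τᵖ z :* v :* a :- z :* βᵖ z :* b :- z :* z :* (con (+ 2) :+ z) :* c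

  -- The partial sums Σ_{k≤m} X k telescope to Pᵖ.
  Pᵖ : ∀ {n} (z v a b c : Polynomial n) → Polynomial n
  Pᵖ z v a b c = con (+ 2) :* τᵖ z :* (a :- con (+ 1)) :- βᵖ z :* (b :- con (+ 1)) :- z :* z :* (con (+ 1) :- c)

  partialSum : ∀ m → sumₛ (suc m) X ≈ₛ
    const (+ 2) *ₛ τ *ₛ (pow (const (+ 1) +ₛ v) m -ₛ const (+ 1)) -ₛ β *ₛ (pow τ m -ₛ const (+ 1))
      -ₛ zₛ *ₛ zₛ *ₛ (const (+ 1) -ₛ pow (negₛ τ) m)
  partialSum zero    = solve 2 (λ z v → con (+ 0) :+ con (+ 0) := Pᵖ z v (con (+ 1)) (con (+ 1)) (con (+ 1)))
                             ≈ₛ-refl zₛ v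
  partialSum (suc m) = ≈ₛ-trans (+ₛ-congʳ (X (suc m)) (partialSum m))
    (solve 5 (λ z v a b c → Pᵖ z v a b c :+ Xᵖ z v a b c
                          := Pᵖ z v ((con (+ 1) :+ v) :* a) (τᵖ z :* b) ((:- τᵖ z) :* c))
           ≈ₛ-refl zₛ v (pow (const (+ 1) +ₛ v) m) (pow τ m) (pow (negₛ τ) m))

  G-Φ : ∀ k → G k *ₛ Φ ≈ₛ zₛ *ₛ (pow τ k +ₛ pow (negₛ τ) k) *ₛ β
  G-Φ k = ≈ₛ-trans (solve 2 (λ g b → g :* (con (+ 2) :* b) := con (+ 2) :* g :* b) ≈ₛ-refl (G k) β)
                   (*ₛ-congʳ β (twice-G k))

  explicitSolution : Solves G (W *ₛ const (+ 1)) X Φ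
  explicitSolution = record
    { base = ≈ₛ-refl
    ; head = solve 2 (λ z v → con (+ 2) :* βᵖ z
                           := con (+ 2) :* τᵖ z :* (con (+ 2) :- z :* v) :* con (+ 1)
                              :+ z :* (Xᵖ z v (con (+ 1)) (con (+ 1)) (con (+ 1))
                                       :+ z :* con (+ 1) :* (con (+ 2) :* βᵖ z)))
                   ≈ₛ-refl zₛ v
    ; tail = λ m → let a = pow (const (+ 1) +ₛ v) m ; b = pow τ m ; c = pow (negₛ τ) m in begin
        X (suc m)
          ≈⟨ byCertificate eqn (const (- + 2) *ₛ τ *ₛ a)
               (solve 5 (λ z v a b c →
                  Xᵖ z v a b c
                  := z :* (Xᵖ z v ((con (+ 1) :+ v) :* a) (τᵖ z :* b) ((:- τᵖ z) :* c)
                           :+ z :* (τᵖ z :* b :+ (:- τᵖ z) :* c) :* βᵖ z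
                           :+ Pᵖ z v a b c)
                     :+ con (- + 2) :* τᵖ z :* a :* (z :* (con (+ 1) :+ v :+ v :* v) :- v))
                  ≈ₛ-refl zₛ v a b c) ⟩
        zₛ *ₛ (X (suc (suc m)) +ₛ zₛ *ₛ (pow τ (suc m) +ₛ pow (negₛ τ) (suc m)) *ₛ β
               +ₛ (const (+ 2) *ₛ τ *ₛ (a -ₛ const (+ 1)) -ₛ β *ₛ (b -ₛ const (+ 1))
                   -ₛ zₛ *ₛ zₛ *ₛ (const (+ 1) -ₛ c)))
          ≈˘⟨ *ₛ-congˡ zₛ (+ₛ-cong (+ₛ-congˡ (X (suc (suc m))) (G-Φ (suc m))) (partialSum m)) ⟩
        zₛ *ₛ (X (suc (suc m)) +ₛ G (suc m) *ₛ Φ +ₛ sumₛ (suc m) X) ∎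
    }
    where open ≈ₛ-Reasoning

open GeneratingFunctions using (F; pathSolution)

-- Uniqueness of the solution of the system, applied to the path solution
-- scaled by W and to the explicit solution, gives W F₀ = Φ; cancelling 2
-- and the factor 2 − zv (by β = (τ + zv)(2 − zv)) leaves τ F₀ = τ + z v.
F₀-in-v : ∀ {v} → VEquation v → τ *ₛ F 0 ≈ₛ τ +ₛ zₛ *ₛ v
F₀-in-v {v} eqn = *ₛ-cancelʳ (const (+ 2) -ₛ zₛ *ₛ v) (λ ()) (begin
  τ *ₛ F 0 *ₛ (const (+ 2) -ₛ zₛ *ₛ v)   ≈⟨ *ₛ-cancelʳ (const (+ 2)) (λ ()) (begin
      τ *ₛ F 0 *ₛ (const (+ 2) -ₛ zₛ *ₛ v) *ₛ const (+ 2)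
        ≈⟨ solve 3 (λ f z v → (con (+ 1) :+ z) :* f :* (con (+ 2) :- z :* v) :* con (+ 2)
                           := con (+ 2) :* (con (+ 1) :+ z) :* (con (+ 2) :- z :* v) :* f)
                 ≈ₛ-refl (F 0) zₛ v ⟩
      W *ₛ F 0                            ≈⟨ solution-unique (solution-scale W pathSolution) explicitSolution ⟩
      const (+ 2) *ₛ β                    ≈⟨ solve 1 (λ b → con (+ 2) :* b := b :* con (+ 2)) ≈ₛ-refl β ⟩
      β *ₛ const (+ 2)                    ∎) ⟩
  β                                        ≈˘⟨ β-factorisation eqn ⟩
  (τ +ₛ zₛ *ₛ v) *ₛ (const (+ 2) -ₛ zₛ *ₛ v) ∎)
  where
  open ≈ₛ-Reasoning
  open ExplicitSolution eqn using (W; explicitSolution)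

-- The three closed forms

module ClosedForms {A : Series} where

  v-form : ∀ {v} → VEquation v → τ *ₛ A ≈ₛ τ +ₛ zₛ *ₛ v →
    A *ₛ ((const (+ 1) +ₛ v) *ₛ (const (+ 1) +ₛ v)) ≈ₛ const (+ 1) +ₛ const (+ 2) *ₛ v +ₛ const (+ 2) *ₛ v *ₛ v
  v-form {v} eqn τA≈ = *ₛ-cancelʳ τ (λ ()) (begin
    A *ₛ ((const (+ 1) +ₛ v) *ₛ (const (+ 1) +ₛ v)) *ₛ τ
      ≈⟨ solve 3 (λ a v t → a :* ((con (+ 1) :+ v) :* (con (+ 1) :+ v)) :* t
                          := t :* a :* ((con (+ 1) :+ v) :* (con (+ 1) :+ v))) ≈ₛ-refl A v τ ⟩
    τ *ₛ A *ₛ ((const (+ 1) +ₛ v) *ₛ (const (+ 1) +ₛ v))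
      ≈⟨ *ₛ-congʳ ((const (+ 1) +ₛ v) *ₛ (const (+ 1) +ₛ v)) τA≈ ⟩
    (τ +ₛ zₛ *ₛ v) *ₛ ((const (+ 1) +ₛ v) *ₛ (const (+ 1) +ₛ v))
      ≈⟨ square-identity eqn ⟩
    (const (+ 1) +ₛ const (+ 2) *ₛ v +ₛ const (+ 2) *ₛ v *ₛ v) *ₛ τ ∎)
    where open ≈ₛ-Reasoning

  Ŝ : Series
  Ŝ = const (+ 1) -ₛ zₛ -ₛ const (+ 2) *ₛ zₛ *ₛ v̂

  Ŝ-unique : ∀ {S} → S 0 ≡ + 1 →
    S *ₛ S ≈ₛ const (+ 1) -ₛ const (+ 2) *ₛ zₛ -ₛ const (+ 3) *ₛ zₛ *ₛ zₛ → S ≈ₛ Ŝ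
  Ŝ-unique S₀≡1 S² = sqrt-unique S₀≡1 refl (≈ₛ-trans S² (≈ₛ-sym (sqrt-identity v̂-equation)))

  sqrt-form : τ *ₛ A ≈ₛ τ +ₛ zₛ *ₛ v̂ → ∀ {S} → S 0 ≡ + 1 →
    S *ₛ S ≈ₛ const (+ 1) -ₛ const (+ 2) *ₛ zₛ -ₛ const (+ 3) *ₛ zₛ *ₛ zₛ →
    const (+ 2) *ₛ τ *ₛ A ≈ₛ const (+ 3) +ₛ zₛ -ₛ S
  sqrt-form τA≈ {S} S₀≡1 S² = begin
    const (+ 2) *ₛ τ *ₛ A      ≈⟨ solve 2 (λ t a → con (+ 2) :* t :* a := con (+ 2) :* (t :* a)) ≈ₛ-refl τ A ⟩
    const (+ 2) *ₛ (τ *ₛ A)    ≈⟨ *ₛ-congˡ (const (+ 2)) τA≈ ⟩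
    const (+ 2) *ₛ (τ +ₛ zₛ *ₛ v̂)
      ≈⟨ solve 2 (λ z v → con (+ 2) :* (con (+ 1) :+ z :+ z :* v)
                        := con (+ 3) :+ z :- (con (+ 1) :- z :- con (+ 2) :* z :* v)) ≈ₛ-refl zₛ v̂ ⟩
    const (+ 3) +ₛ zₛ -ₛ Ŝ     ≈˘⟨ -ₛ-congˡ (const (+ 3) +ₛ zₛ) (Ŝ-unique S₀≡1 S²) ⟩
    const (+ 3) +ₛ zₛ -ₛ S     ∎
    where open ≈ₛ-Reasoning

  -- A = 1/(1 − z²/(1 − w²)) where w = 2z(1 + z)/(1 + z + S) = z τ/(1 − z v̂).
  cf-form : τ *ₛ A ≈ₛ τ +ₛ zₛ *ₛ v̂ → ∀ {S w} → S 0 ≡ + 1 →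
    S *ₛ S ≈ₛ const (+ 1) -ₛ const (+ 2) *ₛ zₛ -ₛ const (+ 3) *ₛ zₛ *ₛ zₛ →
    w *ₛ (const (+ 1) +ₛ zₛ +ₛ S) ≈ₛ const (+ 2) *ₛ zₛ *ₛ (const (+ 1) +ₛ zₛ) →
    A *ₛ (const (+ 1) -ₛ w *ₛ w -ₛ zₛ *ₛ zₛ) ≈ₛ const (+ 1) -ₛ w *ₛ w
  cf-form τA≈ {S} {w} S₀≡1 S² w-def = *ₛ-cancelʳ (τ *ₛ u *ₛ u) (λ ()) (begin
    A *ₛ (const (+ 1) -ₛ w *ₛ w -ₛ zₛ *ₛ zₛ) *ₛ (τ *ₛ u *ₛ u)
      ≈⟨ solve 4 (λ a z v w → let u = con (+ 1) :- z :* v ; t = con (+ 1) :+ z in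
                     a :* (con (+ 1) :- w :* w :- z :* z) :* (t :* u :* u)
                  := t :* a :* (u :* u :- (w :* u) :* (w :* u) :- z :* z :* (u :* u)))
               ≈ₛ-refl A zₛ v̂ w ⟩
    τ *ₛ A *ₛ (u *ₛ u -ₛ (w *ₛ u) *ₛ (w *ₛ u) -ₛ zₛ *ₛ zₛ *ₛ (u *ₛ u))
      ≈⟨ *ₛ-cong τA≈ (-ₛ-congʳ (zₛ *ₛ zₛ *ₛ (u *ₛ u)) (-ₛ-congˡ (u *ₛ u) (*ₛ-cong wu≈zτ wu≈zτ))) ⟩
    (τ +ₛ zₛ *ₛ v̂) *ₛ (u *ₛ u -ₛ (zₛ *ₛ τ) *ₛ (zₛ *ₛ τ) -ₛ zₛ *ₛ zₛ *ₛ (u *ₛ u))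
      ≈⟨ cf-identity v̂-equation ⟩
    τ *ₛ (u *ₛ u -ₛ (zₛ *ₛ τ) *ₛ (zₛ *ₛ τ))
      ≈˘⟨ *ₛ-congˡ τ (-ₛ-congˡ (u *ₛ u) (*ₛ-cong wu≈zτ wu≈zτ)) ⟩
    τ *ₛ (u *ₛ u -ₛ (w *ₛ u) *ₛ (w *ₛ u))
      ≈⟨ solve 4 (λ z v w t → let u = con (+ 1) :- z :* v in
                     t :* (u :* u :- (w :* u) :* (w :* u)) := (con (+ 1) :- w :* w) :* (t :* u :* u))
               ≈ₛ-refl zₛ v̂ w τ ⟩
    (const (+ 1) -ₛ w *ₛ w) *ₛ (τ *ₛ u *ₛ u) ∎)
    where
    open ≈ₛ-Reasoning
    u : Series
    u = zu₁ v̂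
    -- 1 + z + S = 1 + z + Ŝ = 2u, so the definition of w says w u = z τ.
    wu≈zτ : w *ₛ u ≈ₛ zₛ *ₛ τ
    wu≈zτ = *ₛ-cancelʳ (const (+ 2)) (λ ()) (begin
      w *ₛ u *ₛ const (+ 2)
        ≈⟨ solve 3 (λ w z v → w :* (con (+ 1) :- z :* v) :* con (+ 2)
                            := w :* (con (+ 1) :+ z :+ (con (+ 1) :- z :- con (+ 2) :* z :* v)))
                 ≈ₛ-refl w zₛ v̂ ⟩
      w *ₛ (const (+ 1) +ₛ zₛ +ₛ Ŝ)   ≈˘⟨ *ₛ-congˡ w (+ₛ-congˡ (const (+ 1) +ₛ zₛ) (Ŝ-unique S₀≡1 S²)) ⟩
      w *ₛ (const (+ 1) +ₛ zₛ +ₛ S)   ≈⟨ w-def ⟩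
      const (+ 2) *ₛ zₛ *ₛ τ          ≈⟨ solve 2 (λ z t → con (+ 2) :* z :* t := z :* t :* con (+ 2)) ≈ₛ-refl zₛ τ ⟩
      zₛ *ₛ τ *ₛ const (+ 2)          ∎)

open Counting using (count; count-correct)

mainTheorem1 : (a : ℕ → ℕ) → ((n : ℕ) → Fin (a n) ↔ GoodPaths n) →
  let A : Series
      A n = + (a n)
  in ((S w : Series) → S 0 ≡ + 1 →
        S *ₛ S ≈ₛ const (+ 1) -ₛ const (+ 2) *ₛ zₛ -ₛ const (+ 3) *ₛ zₛ *ₛ zₛ →
        w *ₛ (const (+ 1) +ₛ zₛ +ₛ S) ≈ₛ const (+ 2) *ₛ zₛ *ₛ (const (+ 1) +ₛ zₛ) →
        A *ₛ (const (+ 1) -ₛ w *ₛ w -ₛ zₛ *ₛ zₛ) ≈ₛ const (+ 1) -ₛ w *ₛ w)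
   × ((S : Series) → S 0 ≡ + 1 →
        S *ₛ S ≈ₛ const (+ 1) -ₛ const (+ 2) *ₛ zₛ -ₛ const (+ 3) *ₛ zₛ *ₛ zₛ →
        const (+ 2) *ₛ (const (+ 1) +ₛ zₛ) *ₛ A ≈ₛ const (+ 3) +ₛ zₛ -ₛ S)
   × ((v : Series) → v 0 ≡ + 0 →
        zₛ *ₛ (const (+ 1) +ₛ v +ₛ v *ₛ v) ≈ₛ v →
        A *ₛ ((const (+ 1) +ₛ v) *ₛ (const (+ 1) +ₛ v))
          ≈ₛ const (+ 1) +ₛ const (+ 2) *ₛ v +ₛ const (+ 2) *ₛ v *ₛ v)
   × (a 0 ≡ 1 × a 1 ≡ 0 × a 2 ≡ 1 × a 3 ≡ 0 × a 4 ≡ 2 × a 5 ≡ 2 × a 6 ≡ 7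
       × a 7 ≡ 14 × a 8 ≡ 37 × a 9 ≡ 90 × a 10 ≡ 233)
-- The closed forms follow from τ A = τ + z v; in the third, v₀ = 0 is implied
-- by the functional equation and not needed.  The coefficients are values of
-- count, evaluated by computation.
mainTheorem1 a enum =
    (λ S w → cf-form (τA≈ v̂-equation) {S} {w})
  , (λ S → sqrt-form (τA≈ v̂-equation) {S})
  , (λ v _ eqn → v-form eqn (τA≈ eqn))
  , (a≡count 0 , a≡count 1 , a≡count 2 , a≡count 3 , a≡count 4 , a≡count 5 ,
     a≡count 6 , a≡count 7 , a≡count 8 , a≡count 9 , a≡count 10)
  where
  A : Series
  A n = + (a n)
  open ClosedForms {A}
  a≡count : ∀ n → a n ≡ count 0 nothing n
  a≡count = count-correct a enum
  τA≈ : ∀ {v} → VEquation v → τ *ₛ A ≈ₛ τ +ₛ zₛ *ₛ v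
  τA≈ eqn = ≈ₛ-trans (*ₛ-congˡ τ (cong +_ ∘ a≡count)) (F₀-in-v eqn)
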